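{- Let $G$ be a graph on the vertex set $[n]$. If there exists an orientation $D$ of the edges of $G$ such that $d^+_D(u)\le d$ for every $u\in[n]$, then $\tau(G,n)\le\tau_{\text{lab}}(G,n)\le dn$.
   Context: Semi-random no-replacement multigraph process on $[n]=\{1,\dots,n\}$: let $\pi_1,\pi_2,\dots$ be independent uniformly random permutations in $S_n$. Builder's multigraph starts empty on $[n]$. In round $k\ge1$ Builder is offered the vertex $v_k:=\pi_{\lceil k/n\rceil}(k-\lfloor (k-1)/n\rfloor n)$; Builder then chooses a vertex $u_k$ according to his strategy (a rule depending on the history so far) and adds the edge $u_kv_k$ (multiple edges allowed). For a family $\mathcal F$ of labeled graphs on $[n]$ and a strategy $\mathcal S$, $\tau(\mathcal S)$ is the least $m$ such that Builder's multigraph after $m$ rounds contains some member of $\mathcal F$ as a subgraph. $\tau_{\text{lab}}(\mathcal F,n)$ is a random variable with $\Pr(\tau_{\text{lab}}(\mathcal F,n)\le k)=\max_{\mathcal S}\Pr(\tau(\mathcal S)\le k)$ for all $k\ge0$; $\tau(\mathcal F,n):=\tau_{\text{lab}}(\mathcal F_{\text{iso}},n)$ with $\mathcal F_{\text{iso}}$ the labeled graphs on $[n]$ isomorphic to a member of $\mathcal F$; $\tau_{\text{lab}}(G,n),\tau(G,n)$ for $\mathcal F=\{G\}$. These are coupled so that $\tau(\mathcal F,n)\le\tau_{\text{lab}}(\mathcal F,n)$. $d^+_D(u)$ is the out-degree of $u$ in $D$. -}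

module Defs where

open import Data.Nat using (ℕ; _+_; _*_; _≤_)
open import Data.Bool using (Bool; true; false; if_then_else_)
open import Data.Fin using (Fin)
open import Data.Fin.Permutation using (Permutation′; _⟨$⟩ʳ_)
open import Data.List using (List; []; _∷_; _++_; [_]; map; concatMap)
open import Data.Nat.ListAction using (sum)
open import Data.List.Relation.Unary.Any using (Any)
open import Data.Product using (_×_; _,_; Σ)
open import Data.Sum using (_⊎_)
open import Data.Empty using (⊥)
open import Relation.Binary.PropositionalEquality using (_≡_)

open import Data.List using (allFin) public

record Graph (n : ℕ) : Set where
  field
    adj     : Fin n → Fin n → Bool
    adj-sym : ∀ x y → adj x y ≡ adj y x
    adj-irr : ∀ x → adj x x ≡ false
open Graph public

record Orientation {n : ℕ} (G : Graph n) : Set where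
  field
    arc       : Fin n → Fin n → Bool
    arc-edge  : ∀ x y → arc x y ≡ true → adj G x y ≡ true
    edge-arc  : ∀ x y → adj G x y ≡ true → arc x y ≡ true ⊎ arc y x ≡ true
    arc-asym  : ∀ x y → arc x y ≡ true → arc y x ≡ true → ⊥
open Orientation public

outdeg : ∀ {n} {G : Graph n} → Orientation G → Fin n → ℕ
outdeg D u = sum (map (λ y → if arc D u y then 1 else 0) (allFin _))

-- A (deterministic) Builder strategy: given the history of offered vertices
-- (chronological order) and the currently offered vertex v_k, choose u_k.
Strategy : ℕ → Set
Strategy n = List (Fin n) → Fin n → Fin n

-- The offered vertices of the first d·n rounds, determined by π_1,…,π_d:
-- round (i-1)n + j offers π_i(j).
offered : ∀ {n d} → (Fin d → Permutation′ n) → List (Fin n)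
offered {n} {d} π = concatMap (λ i → map (λ j → π i ⟨$⟩ʳ j) (allFin n)) (allFin d)

runFrom : ∀ {n} → Strategy n → List (Fin n) → List (Fin n) → List (Fin n × Fin n)
runFrom S hist []       = []
runFrom S hist (v ∷ vs) = (S hist v , v) ∷ runFrom S (hist ++ [ v ]) vs

run : ∀ {n} → Strategy n → List (Fin n) → List (Fin n × Fin n)
run S vs = runFrom S [] vs

HasEdge : ∀ {n} → List (Fin n × Fin n) → Fin n → Fin n → Set
HasEdge es x y = Any (λ e → e ≡ (x , y) ⊎ e ≡ (y , x)) es

ContainsLab : ∀ {n} → Graph n → List (Fin n × Fin n) → Set
ContainsLab G es = ∀ x y → adj G x y ≡ true → HasEdge es x y

ContainsIso : ∀ {n} → Graph n → List (Fin n × Fin n) → Set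
ContainsIso {n} G es =
  Σ (Permutation′ n) λ σ → ∀ x y → adj G x y ≡ true → HasEdge es (σ ⟨$⟩ʳ x) (σ ⟨$⟩ʳ y)

-- "τ ≤ d·n with probability 1": some strategy achieves the property within
-- the first d·n rounds for every outcome π_1,…,π_d (all outcomes have
-- positive probability under the uniform measure, and edges only accumulate).
SurelyWithin : (n d : ℕ) → (List (Fin n × Fin n) → Set) → Set
SurelyWithin n d P = Σ (Strategy n) λ S → ∀ (π : Fin d → Permutation′ n) → P (run S (offered π))

-- Builder answers the c-th offer of a
-- vertex v (counting from 0) by joining v to its c-th out-neighbour.  Each
-- of π₁,…,π_d offers every vertex once, so within d·n rounds every vertex is
-- offered d ≥ d⁺(v) times and all arcs of D, hence all edges of G, are
-- built.  The identity permutation witnesses the unlabeled version.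
module Submission where

open import Defs
open import Data.Nat using (ℕ; _≤_)
open import Data.Fin using (Fin)
open import Data.Product using (_×_)

open import Data.Bool using (Bool; true; false; if_then_else_)
open import Data.Bool.Properties using (T-≡)
open import Data.Empty using (⊥-elim)
open import Data.Fin using (toℕ)
open import Data.Fin.Permutation using (Permutation′; _⟨$⟩ʳ_; _⟨$⟩ˡ_; inverseʳ)
import Data.Fin.Permutation as Permutation
import Data.Fin.Properties as Fin
open import Data.List using (List; []; _∷_; _++_; [_]; length; map; concat; filter; lookup)
open import Data.List.Membership.Propositional using (_∈_)
open import Data.List.Membership.Propositional.Properties using (∈-allFin; ∈-map⁺; ∈-filter⁺)
open import Data.List.Properties using (length-++; length-map; length-tabulate; filter-++; filter-accept; filter-reject; filter-some; ++-assoc; ++-identityʳ)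
open import Data.List.Relation.Unary.All using (All; []; _∷_; universal)
open import Data.List.Relation.Unary.All.Properties using (map⁺)
open import Data.List.Relation.Unary.Any using (here; there; index)
import Data.List.Relation.Unary.Any as Any
open import Data.List.Relation.Unary.Any.Properties using (lookup-index)
open import Data.Nat using (zero; suc; _+_; _<_; z≤n)
open import Data.Nat.ListAction using (sum)
open import Data.Nat.Properties using (+-identityʳ; +-comm; +-mono-≤; ≤-trans; <-≤-trans; <⇒≱; m≤n⇒m<n∨m≡n)
open import Data.Product using (_,_)
open import Data.Sum using (inj₁; inj₂)
open import Function using (_∘_)
open import Function.Bundles using (Equivalence)
open import Relation.Binary.Definitions using (DecidableEquality)
open import Relation.Binary.PropositionalEquality using (_≡_; _≢_; refl; sym; trans; cong; subst)
open import Relation.Nullary using (yes; no)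
open import Relation.Nullary.Decidable using (T?)

module Occurrences {a} {A : Set a} (_≟_ : DecidableEquality A) where

  count : A → List A → ℕ
  count v = length ∘ filter (v ≟_)

  count-++ : ∀ v xs ys → count v (xs ++ ys) ≡ count v xs + count v ys
  count-++ v xs ys = trans (cong length (filter-++ (v ≟_) xs ys)) (length-++ (filter (v ≟_) xs))

  count-∷ʳ-≡ : ∀ v xs → count v (xs ++ [ v ]) ≡ suc (count v xs)
  count-∷ʳ-≡ v xs = trans (count-++ v xs [ v ])
    (trans (cong (λ ys → count v xs + length ys) (filter-accept (v ≟_) refl)) (+-comm (count v xs) 1))

  count-∷ʳ-≢ : ∀ {v w} xs → v ≢ w → count v (xs ++ [ w ]) ≡ count v xs
  count-∷ʳ-≢ {v} {w} xs v≢w = trans (count-++ v xs [ w ])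
    (trans (cong (λ ys → count v xs + length ys) (filter-reject (v ≟_) v≢w)) (+-identityʳ (count v xs)))

  ∈⇒count>0 : ∀ {v xs} → v ∈ xs → 0 < count v xs
  ∈⇒count>0 = filter-some (_ ≟_)

  length≤count-concat : ∀ {v} (xss : List (List A)) → All (v ∈_) xss → length xss ≤ count v (concat xss)
  length≤count-concat []         []         = z≤n
  length≤count-concat {v} (xs ∷ xss) (v∈xs ∷ v∈xss) =
    subst (suc (length xss) ≤_) (sym (count-++ v xs (concat xss)))
      (+-mono-≤ (∈⇒count>0 v∈xs) (length≤count-concat xss v∈xss))

open module FinOccurrences {n} = Occurrences (Fin._≟_ {n})

lookupOr : ∀ {a} {A : Set a} → List A → A → ℕ → A
lookupOr []       z _       = z
lookupOr (x ∷ xs) z zero    = x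
lookupOr (x ∷ xs) z (suc c) = lookupOr xs z c

lookupOr-toℕ : ∀ {a} {A : Set a} (xs : List A) (z : A) (i : Fin (length xs)) →
  lookupOr xs z (toℕ i) ≡ lookup xs i
lookupOr-toℕ (x ∷ xs) z Fin.zero    = refl
lookupOr-toℕ (x ∷ xs) z (Fin.suc i) = lookupOr-toℕ xs z i

length-filter-T? : ∀ {a} {A : Set a} (p : A → Bool) xs →
  length (filter (T? ∘ p) xs) ≡ sum (map (λ x → if p x then 1 else 0) xs)
length-filter-T? p []       = refl
length-filter-T? p (x ∷ xs) with p x
... | true  = cong suc (length-filter-T? p xs)
... | false = length-filter-T? p xs

permutation-image-∈ : ∀ {n} (σ : Permutation′ n) v → v ∈ map (σ ⟨$⟩ʳ_) (allFin n)
permutation-image-∈ σ v = subst (_∈ _) (inverseʳ σ) (∈-map⁺ (σ ⟨$⟩ʳ_) (∈-allFin (σ ⟨$⟩ˡ v)))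

count-offered : ∀ {n d} (π : Fin d → Permutation′ n) v → d ≤ count v (offered π)
count-offered {n} {d} π v = subst (_≤ count v (offered π)) blocks
  (length≤count-concat (map block (allFin d)) (map⁺ (universal (λ i → permutation-image-∈ (π i) v) _)))
  where
    block : Fin d → List (Fin n)
    block i = map (π i ⟨$⟩ʳ_) (allFin n)
    blocks : length (map block (allFin d)) ≡ d
    blocks = trans (length-map block (allFin d)) (length-tabulate _)

module _ {n} (respond : Fin n → ℕ → Fin n) where

  respondByCount : Strategy n
  respondByCount hist v = respond v (count v hist)

  respondByCount-answers : ∀ {v c} hist vs → count v hist ≤ c → c < count v (hist ++ vs) →
    (respond v c , v) ∈ runFrom respondByCount hist vs
  respondByCount-answers {v} {c} hist [] h≤c c<total =
    ⊥-elim (<⇒≱ (subst (λ ys → c < count v ys) (++-identityʳ hist) c<total) h≤c)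
  respondByCount-answers {v} {c} hist (w ∷ ws) h≤c c<total with v Fin.≟ w
  ... | no v≢w = there (respondByCount-answers (hist ++ [ w ]) ws
                         (subst (_≤ c) (sym (count-∷ʳ-≢ hist v≢w)) h≤c) c<total′)
    where c<total′ = subst (λ ys → c < count v ys) (sym (++-assoc hist [ w ] ws)) c<total
  ... | yes refl with m≤n⇒m<n∨m≡n h≤c
  ...   | inj₂ h≡c = here (cong (λ k → respond v k , v) (sym h≡c))
  ...   | inj₁ h<c = there (respondByCount-answers (hist ++ [ v ]) ws
                              (subst (_≤ c) (sym (count-∷ʳ-≡ v hist)) h<c) c<total′)
    where c<total′ = subst (λ ys → c < count v ys) (sym (++-assoc hist [ v ] ws)) c<total

module _ {n} {G : Graph n} (D : Orientation G) where

  outNeighbours : Fin n → List (Fin n)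
  outNeighbours u = filter (T? ∘ arc D u) (allFin n)

  length-outNeighbours : ∀ u → length (outNeighbours u) ≡ outdeg D u
  length-outNeighbours u = length-filter-T? (arc D u) (allFin n)

  arc⇒∈outNeighbours : ∀ {u y} → arc D u y ≡ true → y ∈ outNeighbours u
  arc⇒∈outNeighbours {u} {y} uy = ∈-filter⁺ (T? ∘ arc D u) (∈-allFin y) (Equivalence.from T-≡ uy)

  nthOutNeighbour : Fin n → ℕ → Fin n
  nthOutNeighbour v = lookupOr (outNeighbours v) v

  outNeighbourBuilder : Strategy n
  outNeighbourBuilder = respondByCount nthOutNeighbour

  outNeighbourBuilder-builds-arcs : ∀ {d} → (∀ u → outdeg D u ≤ d) → (π : Fin d → Permutation′ n) →
    ∀ {u y} → arc D u y ≡ true → (y , u) ∈ run outNeighbourBuilder (offered π)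
  outNeighbourBuilder-builds-arcs out≤d π {u} {y} uy =
    subst (λ x → (x , u) ∈ run outNeighbourBuilder (offered π)) found
      (respondByCount-answers nthOutNeighbour [] (offered π) z≤n i<count)
    where
      y∈N = arc⇒∈outNeighbours uy
      i = index y∈N
      found : nthOutNeighbour u (toℕ i) ≡ y
      found = trans (lookupOr-toℕ (outNeighbours u) u i) (sym (lookup-index y∈N))
      i<count : toℕ i < count u (offered π)
      i<count = <-≤-trans (subst (toℕ i <_) (length-outNeighbours u) (Fin.toℕ<n i))
                          (≤-trans (out≤d u) (count-offered π u))

  outNeighbourBuilder-contains : ∀ {d} → (∀ u → outdeg D u ≤ d) → (π : Fin d → Permutation′ n) →
    ContainsLab G (run outNeighbourBuilder (offered π))
  outNeighbourBuilder-contains out≤d π x y xy with edge-arc D x y xy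
  ... | inj₁ x→y = Any.map (inj₂ ∘ sym) (outNeighbourBuilder-builds-arcs out≤d π x→y)
  ... | inj₂ y→x = Any.map (inj₁ ∘ sym) (outNeighbourBuilder-builds-arcs out≤d π y→x)

proposition3p1 : (n d : ℕ) (G : Graph n) (D : Orientation G) →
    (∀ u → outdeg D u ≤ d) →
    SurelyWithin n d (ContainsIso G) × SurelyWithin n d (ContainsLab G)
proposition3p1 n d G D out≤d =
  (outNeighbourBuilder D , λ π → Permutation.id , outNeighbourBuilder-contains D out≤d π) ,
  (outNeighbourBuilder D , outNeighbourBuilder-contains D out≤d)
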